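{- Let $\sigma$ be a finite or countable signature, let $\psi$ be a strictly limited complexity measure over $\sigma$, and let $S$ be a scheme of computation tree from $\mathrm{Tree}(\sigma)$. Then (a) $\psi(S)\ge h(S)$, and (b) $\psi(S)\ge\max\{\psi(q_j):q_j\in\sigma(S)\}$.
   Context: $\omega=\{0,1,2,\dots\}$, variables $X=\{x_i:i\in\omega\}$. The signature $\sigma$ (predicate and function symbols with arities) is written $\sigma=\{q_0,\dots,q_m\}$ if finite or $\{q_0,q_1,\dots\}$ if infinite; $\sigma^*$ is the set of finite words over the alphabet $\sigma$, including the empty word $\lambda$. A complexity measure over $\sigma$ is a map $\psi:\sigma^*\to\omega$; it is strictly limited if it is computable and $\psi(\alpha_1\alpha_2\alpha_3)>\psi(\alpha_1\alpha_3)$ for all $\alpha_1,\alpha_2,\alpha_3\in\sigma^*$ with $\alpha_2\ne\lambda$. A function expression is $x_j\Leftarrow f(x_{l_1},\dots,x_{l_m})$ with $f$ an $m$-ary function symbol of $\sigma$; an equality-free predicate expression is $r(x_{l_1},\dots,x_{l_k})$ with $r$ a $k$-ary predicate symbol of $\sigma$. A scheme of computation tree in $\mathrm{Tree}(\sigma)$ is $S=(n,G)$, $n\ge1$, $G$ a finite rooted directed tree with function nodes (labeled by a function expression, one outgoing edge), predicate nodes (labeled by an equality-free predicate expression, two outgoing edges labeled $0$ and $1$), and terminal nodes (labeled by numbers from $\omega$, no outgoing edges). A complete path is a directed path $\tau=w_1,d_1,\dots,w_m,d_m,w_{m+1}$ from the root to a terminal node; $\beta_\tau=\beta_1,\dots,\beta_m$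 is the sequence of expressions at $w_1,\dots,w_m$, and $\mathrm{word}(\beta_\tau)=q_{i_1}\cdots q_{i_m}\in\sigma^*$ where $q_{i_j}$ is the symbol of $\sigma$ occurring in $\beta_j$ ($\lambda$ if $m=0$). $\psi(S)=\max\{\psi(\mathrm{word}(\beta_\tau)):\tau$ a complete path of $S\}$; $h(S)$ is the depth, i.e. $\psi(S)$ for $\psi$ the measure counting word length (equivalently the maximum number of non-terminal nodes on a complete path). $\sigma(S)$ is the set of symbols of $\sigma$ used in expressions of $S$ (the maximum over an empty set is taken to be $0$). -}

module Defs where

open import Data.Nat using (ℕ; zero; suc; _⊔_; _<_; _≤_)
open import Data.List using (List; []; _∷_; _++_; map; foldr; length)
open import Data.Vec using (Vec)
open import Data.Product using (Σ)
open import Relation.Binary.PropositionalEquality using (_≡_; _≢_)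
open import Function.Definitions using (Injective)

data Kind : Set where
  predicate function : Kind

-- A finite or countable signature: a set of symbols, each a predicate or a
-- function symbol with an arity, together with an injective enumeration
-- into ω (i.e. σ = {q_0,…,q_m} or {q_0,q_1,…}).
record Signature : Set₁ where
  field
    Sym   : Set
    kind  : Sym → Kind
    arity : Sym → ℕ
    index : Sym → ℕ
    index-injective : Injective _≡_ _≡_ index

open Signature public

-- σ* : finite words over σ (λ = [])
Word : Signature → Set
Word σ = List (Sym σ)

-- Strictly limited complexity measure:
-- ψ(α₁α₂α₃) > ψ(α₁α₃) whenever α₂ ≠ λ.
-- (Computability is automatic for an Agda function.)
StrictlyLimited : (σ : Signature) → (Word σ → ℕ) → Set
StrictlyLimited σ ψ =
  ∀ (α₁ α₂ α₃ : Word σ) → α₂ ≢ [] → ψ (α₁ ++ α₃) < ψ (α₁ ++ α₂ ++ α₃)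

-- The rooted directed tree G of a scheme; variables x_i are given by i ∈ ℕ.
data Tree (σ : Signature) : Set where
  terminal  : ℕ → Tree σ
  -- function node  x_j ⇐ f(x_{l_1},…,x_{l_m}), one outgoing edge
  fnode : (f : Sym σ) → kind σ f ≡ function →
          (j : ℕ) → (ls : Vec ℕ (arity σ f)) → Tree σ → Tree σ
  -- predicate node  r(x_{l_1},…,x_{l_k}), outgoing edges labeled 0 and 1
  pnode : (r : Sym σ) → kind σ r ≡ predicate →
          (ls : Vec ℕ (arity σ r)) → (t₀ t₁ : Tree σ) → Tree σ

record Scheme (σ : Signature) : Set where
  constructor scheme
  field
    n    : ℕ
    1≤n  : 1 ≤ n
    tree : Tree σ

open Scheme public

-- word(β_τ) for all complete paths τ of G (root symbol first).
pathWords : {σ : Signature} → Tree σ → List (Word σ)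
pathWords (terminal _) = [] ∷ []
pathWords (fnode f _ _ _ t) = map (f ∷_) (pathWords t)
pathWords (pnode r _ _ t₀ t₁) = map (r ∷_) (pathWords t₀ ++ pathWords t₁)

maxList : List ℕ → ℕ
maxList = foldr _⊔_ 0

ψ-scheme : {σ : Signature} → (Word σ → ℕ) → Scheme σ → ℕ
ψ-scheme ψ S = maxList (map ψ (pathWords (tree S)))

-- h(S): depth = maximal number of non-terminal nodes on a complete path
h : {σ : Signature} → Scheme σ → ℕ
h S = maxList (map length (pathWords (tree S)))

symbolsTree : {σ : Signature} → Tree σ → List (Sym σ)
symbolsTree (terminal _) = []
symbolsTree (fnode f _ _ _ t) = f ∷ symbolsTree t
symbolsTree (pnode r _ _ t₀ t₁) = r ∷ (symbolsTree t₀ ++ symbolsTree t₁)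

symbols : {σ : Signature} → Scheme σ → List (Sym σ)
symbols S = symbolsTree (tree S)

{-# OPTIONS --safe #-}

-- Inserting a nonempty infix strictly increases a strictly limited measure ψ,
-- so ψ w ≥ |w| and ψ is monotone along subsequences; in particular ψ(q) ≤ ψ(w)
-- whenever q occurs in w. Every symbol of S occurs on some complete path, so
-- both bounds follow by comparing maxima over the complete paths of S.
module Submission where

open import Defs
open import Data.Nat using (ℕ; _≥_; _≤_; z≤n; s≤s)
open import Data.Nat.Properties using (≤-refl; ≤-trans; <⇒≤; ⊔-lub; ⊔-mono-≤; m≤n⇒m≤n⊔o; m≤n⇒m≤o⊔n)
open import Data.List using (List; map; _∷_; []; [_]; _++_; length)
open import Data.List.Properties using (++-assoc; foldr-preservesᵇ; foldr-preservesᵒ)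
open import Data.List.Relation.Unary.All as All using (All)
open import Data.List.Relation.Unary.All.Properties as All using ()
open import Data.List.Relation.Unary.Any as Any using (Any; here; there)
open import Data.List.Relation.Unary.Any.Properties as Any using (++⁺ˡ; ++⁺ʳ)
open import Data.List.Membership.Propositional using (_∈_; lose)
open import Data.List.Membership.Propositional.Properties using (∈-map⁺; ∈-++⁺ˡ; ∈-++⁻)
open import Data.List.Relation.Binary.Sublist.Propositional using (_⊆_; []; _∷_; _∷ʳ_; from∈)
open import Data.Product using (_×_; _,_; ∃)
import Data.Product as Product
open import Data.Sum using (inj₁; inj₂; [_,_]′)
open import Function using (_∘_)
open import Relation.Binary.PropositionalEquality using (refl; cong; subst₂)

maxList-lub : ∀ {m} {ns : List ℕ} → All (_≤ m) ns → maxList ns ≤ m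
maxList-lub = foldr-preservesᵇ ⊔-lub z≤n

≤-maxList : ∀ {m} {ns : List ℕ} → Any (m ≤_) ns → m ≤ maxList ns
≤-maxList {m} {ns} m≤n = foldr-preservesᵒ {P = m ≤_}
  (λ x y → [ m≤n⇒m≤n⊔o y , m≤n⇒m≤o⊔n x ]′) 0 ns (inj₂ m≤n)

maxList-map-mono-pointwise : ∀ {A : Set} {f g : A → ℕ} xs → (∀ x → f x ≤ g x) →
  maxList (map f xs) ≤ maxList (map g xs)
maxList-map-mono-pointwise []       f≤g = z≤n
maxList-map-mono-pointwise (x ∷ xs) f≤g = ⊔-mono-≤ (f≤g x) (maxList-map-mono-pointwise xs f≤g)

maxList-map-mono : ∀ {A B : Set} {f : A → ℕ} {g : B → ℕ} xs ys →
  All (λ x → Any (λ y → f x ≤ g y) ys) xs →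
  maxList (map f xs) ≤ maxList (map g ys)
maxList-map-mono _ _ = maxList-lub ∘ All.map⁺ ∘ All.map (≤-maxList ∘ Any.map⁺)

module StrictlyLimitedMeasure {σ : Signature} {ψ : Word σ → ℕ} (strict : StrictlyLimited σ ψ) where

  length≤ψ : (w : Word σ) → length w ≤ ψ w
  length≤ψ []      = z≤n
  length≤ψ (x ∷ w) = ≤-trans (s≤s (length≤ψ w)) (strict [] [ x ] w λ ())

  ψ-mono-⊆ : ∀ {u w : Word σ} → u ⊆ w → ψ u ≤ ψ w
  ψ-mono-⊆ = mono-after []
    where
    mono-after : ∀ α {u w : Word σ} → u ⊆ w → ψ (α ++ u) ≤ ψ (α ++ w)
    mono-after α []         = ≤-refl
    mono-after α (y ∷ʳ u⊆w) = ≤-trans (mono-after α u⊆w) (<⇒≤ (strict α [ y ] _ λ ()))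
    mono-after α (_∷_ {x = x} refl u⊆w) =
      subst₂ _≤_ (cong ψ (++-assoc α [ x ] _)) (cong ψ (++-assoc α [ x ] _))
        (mono-after (α ++ [ x ]) u⊆w)

  ψ-singleton≤ψ : ∀ {q : Sym σ} {w} → q ∈ w → ψ [ q ] ≤ ψ w
  ψ-singleton≤ψ = ψ-mono-⊆ ∘ from∈

module _ {σ : Signature} where

  ∃-pathWord : (t : Tree σ) → ∃ (_∈ pathWords t)
  ∃-pathWord (terminal _)         = [] , here refl
  ∃-pathWord (fnode f _ _ _ t)    = Product.map (f ∷_) (∈-map⁺ (f ∷_)) (∃-pathWord t)
  ∃-pathWord (pnode r _ _ t₀ t₁)  = Product.map (r ∷_) (∈-map⁺ (r ∷_) ∘ ∈-++⁺ˡ) (∃-pathWord t₀)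

  symbol-on-path : ∀ {q} (t : Tree σ) → q ∈ symbolsTree t → Any (q ∈_) (pathWords t)
  symbol-on-path (fnode f _ _ _ t) (here refl) =
    let w , w∈ = ∃-pathWord t in Any.map⁺ (lose w∈ (here refl))
  symbol-on-path (fnode f _ _ _ t) (there q∈) = Any.map⁺ (Any.map there (symbol-on-path t q∈))
  symbol-on-path (pnode r _ _ t₀ t₁) (here refl) =
    let w , w∈ = ∃-pathWord t₀ in Any.map⁺ (++⁺ˡ (lose w∈ (here refl)))
  symbol-on-path (pnode r _ _ t₀ t₁) (there q∈) with ∈-++⁻ (symbolsTree t₀) q∈
  ... | inj₁ q∈₀ = Any.map⁺ (Any.map there (++⁺ˡ (symbol-on-path t₀ q∈₀)))
  ... | inj₂ q∈₁ = Any.map⁺ (Any.map there (++⁺ʳ (pathWords t₀) (symbol-on-path t₁ q∈₁)))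

lemma1 : (σ : Signature) (ψ : Word σ → ℕ) → StrictlyLimited σ ψ → (S : Scheme σ) →
    (ψ-scheme ψ S ≥ h S) × (ψ-scheme ψ S ≥ maxList (map (λ q → ψ (q ∷ [])) (symbols S)))
lemma1 σ ψ strict S =
  maxList-map-mono-pointwise (pathWords (tree S)) length≤ψ ,
  maxList-map-mono (symbols S) (pathWords (tree S))
    (All.tabulate λ q∈ → Any.map ψ-singleton≤ψ (symbol-on-path (tree S) q∈))
  where open StrictlyLimitedMeasure {σ} {ψ} strict
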